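{- Let $\mathcal{H}$ be a system of constrained Horn clauses over uninterpreted predicates $p_1,\dots,p_m$. For each predicate $p_i$ let $\mathcal{S}_{p_i}$ be a safe zone of $p_i$, $\mathcal{U}_{p_i}$ an unsafe zone of $p_i$, and $\mathcal{L}_{p_i}$ an arbitrary set of data points for $p_i$ (a "partition", i.e. an arbitrary candidate formula). Define four interpretations, for every $i$: $$\tilde{\mathcal{I}}_{l}[p_i]=\mathcal{L}_{p_i},\qquad \tilde{\mathcal{I}}_{lu}[p_i]=\mathcal{L}_{p_i}\land\neg\,\mathcal{U}_{p_i},\qquad \tilde{\mathcal{I}}_{sl}[p_i]=\mathcal{S}_{p_i}\lor\mathcal{L}_{p_i},\qquad \tilde{\mathcal{I}}_{slu}[p_i]=\mathcal{S}_{p_i}\lor\bigl(\mathcal{L}_{p_i}\land\neg\,\mathcal{U}_{p_i}\bigr).$$ Then $\tilde{\mathcal{I}}_{slu}\succeq\tilde{\mathcal{I}}_{sl}$, $\tilde{\mathcal{I}}_{slu}\succeq\tilde{\mathcal{I}}_{lu}$, $\tilde{\mathcal{I}}_{sl}\succeq\tilde{\mathcal{I}}_{l}$ and $\tilde{\mathcal{I}}_{lu}\succeq\tilde{\mathcal{I}}_{l}$, where $A\succeq B$ means: whenever $B$ is a solution interpretation of $\mathcal{H}$, then $A$ is also a solution interpretation of $\mathcal{H}$.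
   Context: A CHC system $\mathcal{H}$ is a finite set of constrained Horn clauses, each of the form $\phi\land p_1(\vec{x}_1)\land\dots\land p_n(\vec{x}_n)\rightarrow h(\vec{x})$ or $\phi\land p_1(\vec{x}_1)\land\dots\land p_n(\vec{x}_n)\rightarrow\bot$, where $\phi$ is a constraint in a background theory and the $p_j,h$ are uninterpreted predicates. A data point for a predicate $p$ of arity $k$ is a tuple of values for its $k$ arguments. An interpretation $\mathcal{I}$ assigns to each predicate $p$ a formula (equivalently, a set of data points) $\mathcal{I}[p]$; we write $\mathcal{I}[p](s)=\top$ if $s$ satisfies it. An interpretation is a solution interpretation of $\mathcal{H}$ if every clause of $\mathcal{H}$ is valid when each predicate $p$ is replaced by $\mathcal{I}[p]$. A positive sample of $p$ is a data point $s^+$ such that $\mathcal{I}^*[p](s^+)=\top$ for every solution interpretation $\mathcal{I}^*$ of $\mathcal{H}$; a negative sample of $p$ is a data point $s^-$ such that $\mathcal{I}^*[p](s^-)=\bot$ for every solution interpretation $\mathcal{I}^*$. A safe zone $\mathcal{S}_p$ of $p$ is a set (symbolically represented) of positive samples of $p$; an unsafe zone $\mathcal{U}_p$ of $p$ is a set of negative samples of $p$. In the hypothesis formulas, $\lor$, $\land$, $\neg$ correspond to union, intersection and complement of the sets of data points. -}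

module Defs where

open import Data.Nat using (ℕ)
open import Data.Fin using (Fin)
open import Data.Vec using (Vec; map)
open import Data.List using (List)
open import Data.List.Relation.Unary.All using (All)
open import Data.Maybe using (Maybe; just; nothing)
open import Data.Product using (_×_)
open import Data.Sum using (_⊎_)
open import Data.Empty using (⊥)
open import Relation.Nullary using (¬_)

module CHC (Val : Set) {m : ℕ} (arity : Fin m → ℕ) where

  Point : Fin m → Set
  Point i = Vec Val (arity i)

  Interp : Set₁
  Interp = (i : Fin m) → Point i → Set

  record Atom (k : ℕ) : Set where
    constructor atom
    field
      pred : Fin m
      args : Vec (Fin k) (arity pred)

  -- a constrained Horn clause  φ ∧ p_1(x⃗_1) ∧ … ∧ p_n(x⃗_n) → h(x⃗)  or  → ⊥
  -- φ is a constraint of the background theory, given semantically as a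
  -- predicate on variable assignments; head = nothing means ⊥.
  record Clause : Set₁ where
    field
      nvars      : ℕ
      constraint : (Fin nvars → Val) → Set
      body       : List (Atom nvars)
      head       : Maybe (Atom nvars)

  System : Set₁
  System = List Clause

  AtomHolds : Interp → {k : ℕ} → (Fin k → Val) → Atom k → Set
  AtomHolds I ρ a = I (Atom.pred a) (map ρ (Atom.args a))

  HeadHolds : Interp → {k : ℕ} → (Fin k → Val) → Maybe (Atom k) → Set
  HeadHolds I ρ nothing  = ⊥
  HeadHolds I ρ (just a) = AtomHolds I ρ a

  ClauseValid : Interp → Clause → Set
  ClauseValid I c =
    (ρ : Fin (Clause.nvars c) → Val) →
    Clause.constraint c ρ →
    All (AtomHolds I ρ) (Clause.body c) →
    HeadHolds I ρ (Clause.head c)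

  IsSolution : System → Interp → Set₁
  IsSolution H I = All (ClauseValid I) H

  PositiveSample : System → (i : Fin m) → Point i → Set₁
  PositiveSample H i s = (I* : Interp) → IsSolution H I* → I* i s

  NegativeSample : System → (i : Fin m) → Point i → Set₁
  NegativeSample H i s = (I* : Interp) → IsSolution H I* → ¬ I* i s

  IsSafeZones : System → Interp → Set₁
  IsSafeZones H S = (i : Fin m) (s : Point i) → S i s → PositiveSample H i s

  IsUnsafeZones : System → Interp → Set₁
  IsUnsafeZones H U = (i : Fin m) (s : Point i) → U i s → NegativeSample H i s

  _⪰⟨_⟩_ : Interp → System → Interp → Set₁
  A ⪰⟨ H ⟩ B = IsSolution H B → IsSolution H A

  I-l : Interp → Interp
  I-l L = L

  I-lu : Interp → Interp → Interp
  I-lu L U i s = L i s × ¬ U i s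

  I-sl : Interp → Interp → Interp
  I-sl S L i s = S i s ⊎ L i s

  I-slu : Interp → Interp → Interp → Interp
  I-slu S L U i s = S i s ⊎ (L i s × ¬ U i s)

-- Satisfiability of a clause only depends on which data points an interpretation
-- contains, so extensionally equal interpretations have the same solutions.  Every
-- solution contains the safe zones and avoids the unsafe zones; hence adding S to,
-- or removing U from, a solution interpretation does not change it as a set.
-- Since I-slu S L U is I-sl S (I-lu L U), all four comparisons reduce to these two facts.
module Submission where

open import Defs
open import Data.Nat using (ℕ)
open import Data.Fin using (Fin)
open import Data.Product using (_×_; _,_; proj₁)
open import Data.Sum using (inj₁; inj₂; [_,_])
open import Data.Maybe using (just; nothing)
open import Data.List.Relation.Unary.All as All using (All)
open import Relation.Nullary using (¬_)
open import Function using (id)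

module Zones (Val : Set) {m : ℕ} (arity : Fin m → ℕ) where
  open CHC Val arity

  infix 4 _⊆_ _≐_

  _⊆_ : Interp → Interp → Set
  A ⊆ B = ∀ i s → A i s → B i s

  _≐_ : Interp → Interp → Set
  A ≐ B = (A ⊆ B) × (B ⊆ A)

  Disjoint : Interp → Interp → Set
  Disjoint A B = ∀ i s → A i s → ¬ B i s

  ClauseValid-resp-≐ : ∀ {A B} c → A ≐ B → ClauseValid B c → ClauseValid A c
  ClauseValid-resp-≐ {A} {B} c (A⊆B , B⊆A) valid ρ φ body =
    head⇒ (Clause.head c) (valid ρ φ (All.map (λ {a} → A⊆B (Atom.pred a) _) body))
    where
    head⇒ : ∀ h → HeadHolds B ρ h → HeadHolds A ρ h
    head⇒ nothing  ()
    head⇒ (just a) = B⊆A (Atom.pred a) _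

  IsSolution-resp-≐ : ∀ {H A B} → A ≐ B → IsSolution H B → IsSolution H A
  IsSolution-resp-≐ A≐B = All.map (λ {c} → ClauseValid-resp-≐ c A≐B)

  safeZones⊆solution : ∀ {H S I} → IsSafeZones H S → IsSolution H I → S ⊆ I
  safeZones⊆solution safe sol i s x = safe i s x _ sol

  solution-disjoint-unsafeZones : ∀ {H U I} → IsUnsafeZones H U → IsSolution H I →
                                  Disjoint I U
  solution-disjoint-unsafeZones unsafe sol i s x u = unsafe i s u _ sol x

  Disjoint-⊆ˡ : ∀ {A B C} → A ⊆ B → Disjoint B C → Disjoint A C
  Disjoint-⊆ˡ A⊆B B∩C≡∅ i s a = B∩C≡∅ i s (A⊆B i s a)

  I-sl-absorb : ∀ {S L} → S ⊆ L → I-sl S L ≐ L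
  I-sl-absorb S⊆L = (λ i s → [ S⊆L i s , id ]) , (λ i s → inj₂)

  I-lu-absorb : ∀ {L U} → Disjoint L U → I-lu L U ≐ L
  I-lu-absorb L∩U≡∅ = (λ i s → proj₁) , (λ i s l → l , L∩U≡∅ i s l)

  I-sl-congʳ : ∀ {S L L′} → L ≐ L′ → I-sl S L ≐ I-sl S L′
  I-sl-congʳ (L⊆L′ , L′⊆L) =
    (λ i s → [ inj₁ , (λ l → inj₂ (L⊆L′ i s l)) ]) ,
    (λ i s → [ inj₁ , (λ l → inj₂ (L′⊆L i s l)) ])

lemma1 : (Val : Set) {m : ℕ} (arity : Fin m → ℕ) →
         let open CHC Val arity in
         (H : System) (S U L : Interp) →
         IsSafeZones H S → IsUnsafeZones H U →
         (I-slu S L U ⪰⟨ H ⟩ I-sl S L) × (I-slu S L U ⪰⟨ H ⟩ I-lu L U) ×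
         (I-sl S L ⪰⟨ H ⟩ I-l L) × (I-lu L U ⪰⟨ H ⟩ I-l L)
lemma1 Val arity H S U L safe unsafe =
  slu⪰sl , slu⪰lu , sl⪰l , lu⪰l
  where
  open CHC Val arity
  open Zones Val arity

  adding-S : ∀ {I} → IsSolution H I → I-sl S I ≐ I
  adding-S sol = I-sl-absorb (safeZones⊆solution safe sol)

  removing-U : ∀ {I} → IsSolution H I → I-lu I U ≐ I
  removing-U sol = I-lu-absorb (solution-disjoint-unsafeZones unsafe sol)

  slu⪰sl : I-slu S L U ⪰⟨ H ⟩ I-sl S L
  slu⪰sl sol = IsSolution-resp-≐ (I-sl-congʳ (I-lu-absorb L∩U≡∅)) sol
    where
    L∩U≡∅ : Disjoint L U
    L∩U≡∅ = Disjoint-⊆ˡ (λ i s → inj₂) (solution-disjoint-unsafeZones unsafe sol)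

  slu⪰lu : I-slu S L U ⪰⟨ H ⟩ I-lu L U
  slu⪰lu sol = IsSolution-resp-≐ (adding-S sol) sol

  sl⪰l : I-sl S L ⪰⟨ H ⟩ I-l L
  sl⪰l sol = IsSolution-resp-≐ (adding-S sol) sol

  lu⪰l : I-lu L U ⪰⟨ H ⟩ I-l L
  lu⪰l sol = IsSolution-resp-≐ (removing-U sol) sol
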